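{- For any two full skew trees $T_1$ and $T_2$ with $n$ internal nodes each, $d_R(T_1,T_2)\le n^2$; that is, $T_1$ can be transformed into $T_2$ by at most $n^2$ rotations such that every intermediate tree is a full skew tree.
   Context: A full binary tree is a rooted ordered tree whose nodes are leaves or internal nodes with exactly two children; a full skew tree is one in which every internal node has at least one leaf child (equivalently, a full binary tree of rank $1$). A right rotation at an internal node $a$ whose left child $b$ is internal, with $C,D$ the subtrees of $b$ and $E$ the right subtree of $a$, replaces the subtree at $a$ by the tree with root $b$, left subtree $C$, right child $a$ having subtrees $D,E$; a left rotation is its inverse. Rank: a leaf has rank $0$; an internal node with children $v,w$ has rank $\mathrm{rank}(v)+1$ if $\mathrm{rank}(v)=\mathrm{rank}(w)$, else $\max\{\mathrm{rank}(v),\mathrm{rank}(w)\}$; a tree's rank is that of its root. $d_R(T_1,T_2)$ is the minimum length of a rotation sequence from $T_1$ to $T_2$ in which every intermediate tree has rank at most $\max\{\mathrm{rank}(T_1),\mathrm{rank}(T_2)\}$. -}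

module Defs where

open import Data.Nat using (ℕ; zero; suc; _+_; _≤_; _⊔_)
open import Data.Nat.Properties using (_≟_)
open import Data.Unit using (⊤)
open import Data.Empty using (⊥)
open import Data.Product using (_×_; Σ)
open import Data.Sum using (_⊎_)
open import Relation.Nullary using (yes; no)

data Tree : Set where
  leaf : Tree
  node : Tree → Tree → Tree

internals : Tree → ℕ
internals leaf       = 0
internals (node l r) = suc (internals l + internals r)

rank : Tree → ℕ
rank leaf = 0
rank (node l r) with rank l ≟ rank r
... | yes _ = suc (rank l)
... | no  _ = rank l ⊔ rank r

IsLeaf : Tree → Set
IsLeaf leaf       = ⊤
IsLeaf (node _ _) = ⊥

FullSkew : Tree → Set
FullSkew leaf       = ⊤
FullSkew (node l r) = (IsLeaf l ⊎ IsLeaf r) × FullSkew l × FullSkew r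

data Rot : Tree → Tree → Set where
  rotR  : ∀ C D E → Rot (node (node C D) E) (node C (node D E))
  rotL  : ∀ C D E → Rot (node C (node D E)) (node (node C D) E)
  left  : ∀ {l l′} r → Rot l l′ → Rot (node l r) (node l′ r)
  right : ∀ l {r r′} → Rot r r′ → Rot (node l r) (node l r′)

data RotSeq (b : ℕ) : ℕ → Tree → Tree → Set where
  done : ∀ {T} → rank T ≤ b → RotSeq b 0 T T
  step : ∀ {k T U V} → rank T ≤ b → Rot T U → RotSeq b k U V →
         RotSeq b (suc k) T V

-- d_R(T₁,T₂) ≤ m : there is a rotation sequence of length at most m
-- whose trees all have rank ≤ max(rank T₁, rank T₂).
dR≤ : Tree → Tree → ℕ → Set
dR≤ T₁ T₂ m = Σ ℕ λ k → k ≤ m × RotSeq (rank T₁ ⊔ rank T₂) k T₁ T₂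

-- A full skew tree is pushed into the right comb by repeatedly rotating the
-- comb that has formed under a left child down the right spine; the tree of
-- n internal nodes needs at most (n choose 2) rotations, all through full
-- skew trees. Going T₁ → comb → T₂ costs 2·(n choose 2) ≤ n², and full skew
-- trees have rank ≤ 1 while both endpoints (for n > 0) have rank ≥ 1.
module Submission where

open import Defs
open import Data.Nat using (ℕ; zero; suc; _+_; _*_; _≤_; _⊔_; z≤n; s≤s)
open import Data.Nat.Properties
open import Data.Nat.Combinatorics using (_C_; nC1≡n; nCk+nC[k+1]≡[n+1]C[k+1])
open import Data.Nat.Tactic.RingSolver using (solve-∀)
open import Data.Empty using (⊥-elim)
open import Data.Product using (_×_; _,_; Σ)
open import Data.Sum using (inj₁; inj₂)
open import Data.Unit using (tt)
open import Relation.Nullary using (yes; no)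
open import Relation.Binary.PropositionalEquality
  using (_≡_; refl; sym; cong; module ≡-Reasoning)

Rot-sym : ∀ {T U} → Rot T U → Rot U T
Rot-sym (rotR a b c) = rotL a b c
Rot-sym (rotL a b c) = rotR a b c
Rot-sym (left r ρ)   = left r (Rot-sym ρ)
Rot-sym (right l ρ)  = right l (Rot-sym ρ)

data Walk (P : Tree → Set) : ℕ → Tree → Tree → Set where
  stop : ∀ {T} → P T → Walk P 0 T T
  move : ∀ {k T U V} → P T → Rot T U → Walk P k U V → Walk P (suc k) T V

module _ {P : Tree → Set} where

  _++ʷ_ : ∀ {k j T U V} → Walk P k T U → Walk P j U V → Walk P (k + j) T V
  stop _     ++ʷ w′ = w′
  move p ρ w ++ʷ w′ = move p ρ (w ++ʷ w′)

  _∷ʳʷ_ : ∀ {k T U V} → Walk P k T U → P V × Rot U V → Walk P (suc k) T V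
  stop p     ∷ʳʷ (q , ρ) = move p ρ (stop q)
  move p σ w ∷ʳʷ qρ      = move p σ (w ∷ʳʷ qρ)

  reverseʷ : ∀ {k T U} → Walk P k T U → Walk P k U T
  reverseʷ (stop p)     = stop p
  reverseʷ (move p ρ w) = reverseʷ w ∷ʳʷ (p , Rot-sym ρ)

  mapʷ : ∀ {Q : Tree → Set} (f : Tree → Tree) →
         (∀ {T U} → Rot T U → Rot (f T) (f U)) → (∀ {T} → P T → Q (f T)) →
         ∀ {k T U} → Walk P k T U → Walk Q k (f T) (f U)
  mapʷ f rot pres (stop p)     = stop (pres p)
  mapʷ f rot pres (move p ρ w) = move (pres p) (rot ρ) (mapʷ f rot pres w)

  walk⇒rotSeq : ∀ {b} → (∀ {T} → P T → rank T ≤ b) →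
                ∀ {k T U} → Walk P k T U → RotSeq b k T U
  walk⇒rotSeq bound (stop p)     = done (bound p)
  walk⇒rotSeq bound (move p ρ w) = step (bound p) ρ (walk⇒rotSeq bound w)

SkewWalk : ℕ → Tree → Tree → Set
SkewWalk = Walk FullSkew

under-right : ∀ {k l l′} → SkewWalk k l l′ → SkewWalk k (node leaf l) (node leaf l′)
under-right = mapʷ (node leaf) (right leaf) (λ fs → inj₁ tt , tt , fs)

under-left : ∀ {k l l′} → SkewWalk k l l′ → SkewWalk k (node l leaf) (node l′ leaf)
under-left = mapʷ (λ l → node l leaf) (left leaf) (λ fs → inj₂ tt , fs , tt)

rightComb : ℕ → Tree
rightComb zero    = leaf
rightComb (suc n) = node leaf (rightComb n)

rightComb-fullSkew : ∀ n → FullSkew (rightComb n)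
rightComb-fullSkew zero    = tt
rightComb-fullSkew (suc n) = inj₁ tt , tt , rightComb-fullSkew n

-- Each rotation moves the trailing leaf one level down the comb's right spine.
rightComb-absorb-leaf : ∀ m → SkewWalk m (node (rightComb m) leaf) (rightComb (suc m))
rightComb-absorb-leaf zero    = stop (rightComb-fullSkew 1)
rightComb-absorb-leaf (suc m) =
  move (inj₂ tt , rightComb-fullSkew (suc m) , tt) (rotR leaf (rightComb m) leaf)
       (under-right (rightComb-absorb-leaf m))

[1+n]C2≡n+nC2 : ∀ n → suc n C 2 ≡ n + n C 2
[1+n]C2≡n+nC2 n = begin
  suc n C 2       ≡⟨ sym (nCk+nC[k+1]≡[n+1]C[k+1] n 1) ⟩
  n C 1 + n C 2   ≡⟨ cong (_+ n C 2) (nC1≡n n) ⟩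
  n + n C 2       ∎
  where open ≡-Reasoning

nC2-mono : ∀ n → n C 2 ≤ suc n C 2
nC2-mono n = ≤-trans (m≤n+m (n C 2) n) (≤-reflexive (sym ([1+n]C2≡n+nC2 n)))

nC2+nC2+n≡n*n : ∀ n → n C 2 + n C 2 + n ≡ n * n
nC2+nC2+n≡n*n zero    = refl
nC2+nC2+n≡n*n (suc n) = begin
  suc n C 2 + suc n C 2 + suc n          ≡⟨ cong (λ c → c + c + suc n) ([1+n]C2≡n+nC2 n) ⟩
  (n + n C 2) + (n + n C 2) + suc n      ≡⟨ regroup n (n C 2) ⟩
  n + n + 1 + (n C 2 + n C 2 + n)        ≡⟨ cong (n + n + 1 +_) (nC2+nC2+n≡n*n n) ⟩
  n + n + 1 + n * n                      ≡⟨ square-suc n ⟩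
  suc n * suc n                          ∎
  where
  open ≡-Reasoning
  regroup : ∀ n c → (n + c) + (n + c) + suc n ≡ n + n + 1 + (c + c + n)
  regroup = solve-∀
  square-suc : ∀ n → n + n + 1 + n * n ≡ suc n * suc n
  square-suc = solve-∀

nC2+nC2≤n*n : ∀ n → n C 2 + n C 2 ≤ n * n
nC2+nC2≤n*n n = ≤-trans (m≤m+n (n C 2 + n C 2) n) (≤-reflexive (nC2+nC2+n≡n*n n))

-- A left subtree with m internal nodes is combed (≤ m C 2 rotations) and then
-- absorbs the right leaf (m rotations), within (m + 1) C 2 = m + m C 2.
toRightComb : ∀ T → FullSkew T →
              Σ ℕ λ k → k ≤ internals T C 2 × SkewWalk k T (rightComb (internals T))
toRightComb leaf _ = 0 , z≤n , stop tt
toRightComb (node leaf r) (_ , _ , fs-r) with toRightComb r fs-r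
... | k , k≤ , w = k , ≤-trans k≤ (nC2-mono (internals r)) , under-right w
toRightComb (node l@(node a b) leaf) (_ , fs-l , _) with toRightComb l fs-l
... | k , k≤ , w rewrite +-identityʳ (internals a + internals b) =
  k + internals l , bound , (under-left w ++ʷ rightComb-absorb-leaf (internals l))
  where
  bound : k + internals l ≤ suc (internals l) C 2
  bound = begin
    k + internals l               ≤⟨ +-monoˡ-≤ (internals l) k≤ ⟩
    internals l C 2 + internals l ≡⟨ +-comm (internals l C 2) (internals l) ⟩
    internals l + internals l C 2 ≡⟨ sym ([1+n]C2≡n+nC2 (internals l)) ⟩
    suc (internals l) C 2         ∎
    where open ≤-Reasoning
toRightComb (node (node _ _) (node _ _)) (inj₁ () , _)
toRightComb (node (node _ _) (node _ _)) (inj₂ () , _)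

fullSkew⇒rank≤1 : ∀ T → FullSkew T → rank T ≤ 1
fullSkew⇒rank≤1 leaf _ = z≤n
fullSkew⇒rank≤1 (node leaf r) (_ , _ , fs-r) with 0 ≟ rank r
... | yes _ = s≤s z≤n
... | no  _ = fullSkew⇒rank≤1 r fs-r
fullSkew⇒rank≤1 (node (node a b) leaf) (_ , fs-l , _)
  with fullSkew⇒rank≤1 (node a b) fs-l | rank (node a b) ≟ 0
... | _       | yes rank-l≡0 = s≤s (≤-reflexive rank-l≡0)
... | rank-l≤1 | no  _ = ≤-trans (≤-reflexive (⊔-identityʳ (rank (node a b)))) rank-l≤1
fullSkew⇒rank≤1 (node (node _ _) (node _ _)) (inj₁ () , _)
fullSkew⇒rank≤1 (node (node _ _) (node _ _)) (inj₂ () , _)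

rank-node≥1 : ∀ l r → 1 ≤ rank (node l r)
rank-node≥1 l r with rank l ≟ rank r
... | yes _ = s≤s z≤n
... | no rank-l≢rank-r with rank l | rank r
... | zero  | zero  = ⊥-elim (rank-l≢rank-r refl)
... | zero  | suc _ = s≤s z≤n
... | suc m | w     = ≤-trans (s≤s z≤n) (m≤m⊔n (suc m) w)

lemma7 : (n : ℕ) (T₁ T₂ : Tree) → FullSkew T₁ → FullSkew T₂ →
         internals T₁ ≡ n → internals T₂ ≡ n → dR≤ T₁ T₂ (n * n)
lemma7 .0 leaf leaf _ _ refl _ = 0 , z≤n , done z≤n
lemma7 .0 leaf (node _ _) _ _ refl ()
lemma7 n (node l r) T₂ fs₁ fs₂ refl n≡ with toRightComb (node l r) fs₁ | toRightComb T₂ fs₂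
... | k₁ , k₁≤ , w₁ | k₂ , k₂≤ , w₂ rewrite n≡ =
  k₁ + k₂ , ≤-trans (+-mono-≤ k₁≤ k₂≤) (nC2+nC2≤n*n n) ,
  walk⇒rotSeq (λ {T} fs → ≤-trans (fullSkew⇒rank≤1 T fs) 1≤bound) (w₁ ++ʷ reverseʷ w₂)
  where
  1≤bound : 1 ≤ rank (node l r) ⊔ rank T₂
  1≤bound = ≤-trans (rank-node≥1 l r) (m≤m⊔n _ _)
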